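{- Let $R\in\mathfrak{U}$, let $\mathfrak{U}'\subseteq\mathfrak{U}$, and let $\mathcal{E}(R)$ be the EV-system of $R$ with respect to $\mathfrak{U}'$. Then for all $\mathfrak{a},\mathfrak{b}\in\mathcal{E}_o(R)$: 1. if $\{\mathfrak{a},\mathfrak{b}\}\in A(\mathcal{E}(R))$, then $\{\mathfrak{a}_1,\mathfrak{b}_1\}\in A(R)$; 2. if $\{\mathfrak{a},\mathfrak{b}\}\in A(\mathcal{E}(R)^*)$, then $\{\mathfrak{a}_1,\mathfrak{b}_1\}\in A(R^*)$, $\mathfrak{a}_1\in\mathfrak{b}_2$ and $\mathfrak{b}_1\in\mathfrak{a}_2$; 3. if $\{\mathfrak{a},\mathfrak{b}\}\in A(\mathcal{E}(R))$ and $\mathfrak{a}_1=\mathfrak{b}_1$, then $\mathfrak{a}=\mathfrak{b}$. Furthermore, if $R^*$ contains no cycle of odd length, then $\mathcal{E}(R)^*$ contains no cycle of odd length.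
   Context: An undirected graph $G$ has a finite nonempty vertex set and an edge set $A(G)$ of 1-element subsets (loops) and 2-element subsets (proper edges) of $V(G)$. $G^*$ is $G$ with loops removed. $N_G(v)=\{w\ne v:\{v,w\}\in A(G)\}$. A homomorphism maps edges to edges; it is strict if, in addition, it maps proper edges to proper edges. $\mathcal{S}_u(G,H)$ is the set of strict homomorphisms. $\mathfrak{U}$ is a representative system of the isomorphism classes of finite undirected graphs. EV-system of $R$ with respect to $\mathfrak{U}'$: - Vertex set $\mathcal{E}_o(R)=\{(v,D):v\in V(R),\ D\subseteq N_R(v)\}$, with components $\mathfrak{a}_1,\mathfrak{a}_2$. - $\alpha^R_{G,\xi}(v)=(\xi(v),\xi[N_G(v)])$. - $\{\mathfrak{a},\mathfrak{b}\}$ ($\mathfrak{a}=\mathfrak{b}$ allowed) is an edge iff there exist $G\in\mathfrak{U}'$, $\xi\in\mathcal{S}_u(G,R)$ and $\{v,w\}\in A(G)$ ($v=w$ allowed) with $\mathfrak{a}=\alpha^R_{G,\xi}(v)$ and $\mathfrak{b}=\alpha^R_{G,\xi}(w)$. -}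

module Defs where

open import Data.Nat using (ℕ; zero; suc; _≤_; _%_)
open import Data.Bool using (Bool; true)
open import Data.Fin using (Fin; fromℕ; inject₁) renaming (zero to fzero; suc to fsuc)
open import Data.Fin.Subset using (Subset; _∈_)
open import Data.Product using (Σ; ∃; _×_; proj₁; proj₂)
open import Relation.Binary.PropositionalEquality using (_≡_; _≢_)
open import Relation.Nullary using (¬_)

-- A finite undirected graph with nonempty vertex set Fin (suc n).
-- adj v w ≡ true  iff  {v,w} ∈ A(G)   (v = w : loop).
record Graph : Set where
  field
    n   : ℕ
    adj : Fin (suc n) → Fin (suc n) → Bool
    sym : ∀ v w → adj v w ≡ adj w v

open Graph public

V : Graph → Set
V G = Fin (suc (n G))

Edge : (G : Graph) → V G → V G → Set
Edge G v w = adj G v w ≡ true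

-- {v,w} ∈ A(G*)  (proper edge)
ProperEdge : (G : Graph) → V G → V G → Set
ProperEdge G v w = v ≢ w × Edge G v w

InNbhd : (G : Graph) → V G → V G → Set
InNbhd G v w = w ≢ v × Edge G v w

IsStrictHom : (G R : Graph) → (V G → V R) → Set
IsStrictHom G R ξ =
  (∀ v w → Edge G v w → Edge R (ξ v) (ξ w)) ×
  (∀ v w → ProperEdge G v w → ProperEdge R (ξ v) (ξ w))

-- Carrier of candidate EV-vertices: pairs (v , D) with D ⊆ V(R)
EVCarrier : Graph → Set
EVCarrier R = V R × Subset (suc (n R))

InEo : (R : Graph) → EVCarrier R → Set
InEo R a = ∀ u → u ∈ proj₂ a → InNbhd R (proj₁ a) u

-- a = α^R_{G,ξ}(v) = (ξ(v), ξ[N_G(v)])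
IsAlpha : (G R : Graph) → (V G → V R) → V G → EVCarrier R → Set
IsAlpha G R ξ v a =
  proj₁ a ≡ ξ v ×
  (∀ u → (u ∈ proj₂ a → ∃ λ w → InNbhd G v w × ξ w ≡ u) ×
         ((∃ λ w → InNbhd G v w × ξ w ≡ u) → u ∈ proj₂ a))

-- edges of the EV-system 𝓔(R) w.r.t. the class 𝔘' (given as predicate U')
EVAdj : (U' : Graph → Set) (R : Graph) → EVCarrier R → EVCarrier R → Set
EVAdj U' R a b =
  InEo R a × InEo R b ×
  Σ Graph λ G → U' G × Σ (V G → V R) λ ξ → IsStrictHom G R ξ ×
    Σ (V G) λ v → Σ (V G) λ w → Edge G v w × IsAlpha G R ξ v a × IsAlpha G R ξ w b

EVProperAdj : (U' : Graph → Set) (R : Graph) → EVCarrier R → EVCarrier R → Set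
EVProperAdj U' R a b = a ≢ b × EVAdj U' R a b

Odd : ℕ → Set
Odd k = k % 2 ≡ 1

HasOddCycle : (A : Set) → (A → A → Set) → Set
HasOddCycle A E =
  Σ ℕ λ m → 3 ≤ suc m × Odd (suc m) ×
  Σ (Fin (suc m) → A) λ c →
    (∀ i j → c i ≡ c j → i ≡ j) ×
    (∀ (i : Fin m) → E (c (inject₁ i)) (c (fsuc i))) ×
    E (c (fromℕ m)) (c fzero)

{-# OPTIONS --safe #-}
-- An EV-edge {α(v), α(w)} comes from an edge {v, w} of some G ∈ 𝔘' under a
-- strict homomorphism ξ.  If v = w both endpoints are the same α-value;
-- otherwise {ξ v, ξ w} is a proper edge of R, and ξ v, ξ w lie in the
-- neighbourhood images of α(w), α(v).  Hence first components map an odd cycle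
-- of 𝓔(R)* to a closed odd walk in the loopless graph R*, and a shortest
-- closed odd walk is a cycle: a repeated vertex splits a closed walk into two
-- shorter closed walks whose lengths add up, so one of them is odd.
module Submission where

open import Defs renaming (sym to adj-sym)
open import Data.Fin using (Fin; toℕ; fromℕ; fromℕ<; inject₁) renaming (zero to fzero; suc to fsuc)
open import Data.Fin.Properties using (toℕ-injective; toℕ<n; toℕ-fromℕ; toℕ-fromℕ<; fromℕ<-toℕ; toℕ-inject₁) renaming (_≟_ to _≟ᶠ_)
open import Data.Fin.Subset using (_∈_)
open import Data.Fin.Subset.Properties using (⊆-antisym)
open import Data.Nat using (ℕ; zero; suc; _+_; _∸_; _≤_; _<_; z≤n; s≤s; z<s; _≤?_; _<?_)
open import Data.Nat.Induction using (<-wellFounded)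
open import Data.Nat.Properties
open import Data.Product using (∃; ∃₂; _×_; _,_; proj₁; proj₂)
open import Data.Sum using (_⊎_; inj₁; inj₂; [_,_]′)
open import Function using (_∘_; id)
open import Induction.WellFounded using (Acc; acc)
open import Relation.Binary.Definitions using (DecidableEquality; tri<; tri≈; tri>)
open import Relation.Binary.PropositionalEquality
  using (_≡_; refl; sym; trans; cong; cong₂; subst; subst₂)
open import Relation.Nullary using (¬_; Dec; yes; no; contradiction)

module _ (G R : Graph) (ξ : V G → V R) (v : V G) where

  IsAlpha-unique : ∀ {a b} → IsAlpha G R ξ v a → IsAlpha G R ξ v b → a ≡ b
  IsAlpha-unique {_ , A} {_ , B} (a≡ξv , αA) (b≡ξv , αB) =
    cong₂ _,_ (trans a≡ξv (sym b≡ξv))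
      (⊆-antisym (λ {u} u∈A → proj₂ (αB u) (proj₁ (αA u) u∈A))
                 (λ {u} u∈B → proj₂ (αA u) (proj₁ (αB u) u∈B)))

  IsAlpha-∈ : ∀ {a w} → IsAlpha G R ξ v a → InNbhd G v w → ξ w ∈ proj₂ a
  IsAlpha-∈ {w = w} (_ , αA) w∈N = proj₂ (αA (ξ w)) (w , w∈N , refl)

module _ (U' : Graph → Set) (R : Graph) where

  EVAdj⇒Edge : ∀ {a b} → EVAdj U' R a b → Edge R (proj₁ a) (proj₁ b)
  EVAdj⇒Edge (_ , _ , G , _ , ξ , (hom , _) , v , w , e , (a≡ξv , _) , (b≡ξw , _)) =
    subst₂ (Edge R) (sym a≡ξv) (sym b≡ξw) (hom v w e)

  EVAdj⇒≡⊎ProperEdge : ∀ {a b} → EVAdj U' R a b →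
    a ≡ b ⊎ (ProperEdge R (proj₁ a) (proj₁ b) × proj₁ a ∈ proj₂ b × proj₁ b ∈ proj₂ a)
  EVAdj⇒≡⊎ProperEdge (_ , _ , G , _ , ξ , (_ , strict) , v , w , e , αa , αb)
    with v ≟ᶠ w
  ... | yes refl = inj₁ (IsAlpha-unique G R ξ v αa αb)
  ... | no v≢w = inj₂
    ( subst₂ (ProperEdge R) (sym (proj₁ αa)) (sym (proj₁ αb)) (strict v w (v≢w , e))
    , subst (_∈ _) (sym (proj₁ αa)) (IsAlpha-∈ G R ξ w αb (v≢w , trans (adj-sym G w v) e))
    , subst (_∈ _) (sym (proj₁ αb)) (IsAlpha-∈ G R ξ v αa (v≢w ∘ sym , e)) )

  EVProperAdj⇒ProperEdge : ∀ {a b} → EVProperAdj U' R a b →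
    ProperEdge R (proj₁ a) (proj₁ b) × proj₁ a ∈ proj₂ b × proj₁ b ∈ proj₂ a
  EVProperAdj⇒ProperEdge (a≢b , e) =
    [ (λ a≡b → contradiction a≡b a≢b) , id ]′ (EVAdj⇒≡⊎ProperEdge e)

  EVAdj-proj₁-injective : ∀ {a b} → EVAdj U' R a b → proj₁ a ≡ proj₁ b → a ≡ b
  EVAdj-proj₁-injective e a₁≡b₁ =
    [ id , (λ p → contradiction a₁≡b₁ (proj₁ (proj₁ p))) ]′ (EVAdj⇒≡⊎ProperEdge e)

odd-+ : ∀ m {n} → Odd (m + n) → Odd m ⊎ Odd n
odd-+ zero          odd = inj₂ odd
odd-+ (suc zero)    _   = inj₁ refl
odd-+ (suc (suc m)) odd = odd-+ m odd

m<n⇒∃[o]m+suc[o]≡n : ∀ {m n} → m < n → ∃ λ o → m + suc o ≡ n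
m<n⇒∃[o]m+suc[o]≡n {m} m<n with o , eq ← m≤n⇒∃[o]m+o≡n m<n = o , trans (+-suc m o) eq

record Walk {A : Set} (P : A → A → Set) (x y : A) (L : ℕ) : Set where
  field
    vertex : ℕ → A
    start  : vertex 0 ≡ x
    finish : vertex L ≡ y
    step   : ∀ k → k < L → P (vertex k) (vertex (suc k))

open Walk

module _ {A : Set} {P : A → A → Set} where

  map : ∀ {B : Set} {Q : B → B → Set} (φ : A → B) → (∀ {x y} → P x y → Q (φ x) (φ y)) →
        ∀ {x y L} → Walk P x y L → Walk Q (φ x) (φ y) L
  map φ hom w = record
    { vertex = φ ∘ vertex w
    ; start  = cong φ (start w)
    ; finish = cong φ (finish w)
    ; step   = λ k k<L → hom (step w k k<L)
    }

  splitAt : ∀ {x y z} m {n} (w : Walk P x y (m + n)) → vertex w m ≡ z →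
            Walk P x z m × Walk P z y n
  splitAt m w wm≡z =
    record { vertex = vertex w ; start = start w ; finish = wm≡z
           ; step = λ k k<m → step w k (<-≤-trans k<m (m≤m+n m _)) } ,
    record { vertex = λ k → vertex w (m + k)
           ; start  = trans (cong (vertex w) (+-identityʳ m)) wm≡z
           ; finish = finish w
           ; step   = λ k k<n → subst (P (vertex w (m + k)) ∘ vertex w) (sym (+-suc m k))
                                      (step w (m + k) (+-monoʳ-< m k<n)) }

  concatVertex : (ℕ → A) → ℕ → (ℕ → A) → ℕ → A
  concatVertex f m g k with k ≤? m
  ... | yes _ = f k
  ... | no  _ = g (k ∸ m)

  concatVertex-≤ : ∀ f m g {k} → k ≤ m → concatVertex f m g k ≡ f k
  concatVertex-≤ f m g {k} k≤m with k ≤? m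
  ... | yes _   = refl
  ... | no  k≰m = contradiction k≤m k≰m

  concatVertex-≥ : ∀ f m g {k} → f m ≡ g 0 → m ≤ k → concatVertex f m g k ≡ g (k ∸ m)
  concatVertex-≥ f m g {k} fm≡g0 m≤k with k ≤? m
  ... | no  _   = refl
  ... | yes k≤m with refl ← ≤-antisym k≤m m≤k = trans fm≡g0 (cong g (sym (n∸n≡0 m)))

  _++_ : ∀ {x y z m n} → Walk P x y m → Walk P y z n → Walk P x z (m + n)
  _++_ {m = m} {n} w₁ w₂ = record
    { vertex = h
    ; start  = trans (concatVertex-≤ f m g z≤n) (start w₁)
    ; finish = trans (concatVertex-≥ f m g meet (m≤m+n m n))
                     (trans (cong g (m+n∸m≡n m n)) (finish w₂))
    ; step   = steps
    }
    where
    f = vertex w₁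
    g = vertex w₂
    h = concatVertex f m g
    meet : f m ≡ g 0
    meet = trans (finish w₁) (sym (start w₂))
    steps : ∀ k → k < m + n → P (h k) (h (suc k))
    steps k k<m+n with <-≤-connex k m
    ... | inj₁ k<m = subst₂ P (sym (concatVertex-≤ f m g (<⇒≤ k<m)))
                             (sym (concatVertex-≤ f m g k<m)) (step w₁ k k<m)
    ... | inj₂ m≤k = subst₂ P (sym (concatVertex-≥ f m g meet m≤k))
                             (sym (trans (concatVertex-≥ f m g meet (m≤n⇒m≤1+n m≤k))
                                         (cong g (+-∸-assoc 1 m≤k))))
                             (step w₂ (k ∸ m)
                                   (subst (k ∸ m <_) (m+n∸m≡n m n) (∸-monoˡ-< k<m+n m≤k)))

  -- Indices beyond suc m are junk; index suc m closes the cycle at c 0.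
  cycleVertex : ∀ {m} → (Fin (suc m) → A) → ℕ → A
  cycleVertex {m} c k with k <? suc m
  ... | yes k<1+m = c (fromℕ< k<1+m)
  ... | no  _     = c fzero

  cycleVertex-toℕ : ∀ {m} (c : Fin (suc m) → A) i {k} → toℕ i ≡ k → cycleVertex c k ≡ c i
  cycleVertex-toℕ {m} c i refl with toℕ i <? suc m
  ... | yes i<1+m = cong c (fromℕ<-toℕ i i<1+m)
  ... | no  i≮1+m = contradiction (toℕ<n i) i≮1+m

  cycleVertex-wrap : ∀ {m} (c : Fin (suc m) → A) → cycleVertex c (suc m) ≡ c fzero
  cycleVertex-wrap {m} c with suc m <? suc m
  ... | yes m<m = contradiction m<m (<-irrefl refl)
  ... | no  _   = refl

  cycle⇒closedWalk : ∀ {m} (c : Fin (suc m) → A) →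
    (∀ (i : Fin m) → P (c (inject₁ i)) (c (fsuc i))) → P (c (fromℕ m)) (c fzero) →
    Walk P (c fzero) (c fzero) (suc m)
  cycle⇒closedWalk {m} c edge closing = record
    { vertex = cycleVertex c
    ; start  = cycleVertex-toℕ c fzero refl
    ; finish = cycleVertex-wrap c
    ; step   = λ k k<1+m → steps k (m<1+n⇒m<n∨m≡n k<1+m)
    }
    where
    steps : ∀ k → k < m ⊎ k ≡ m → P (cycleVertex c k) (cycleVertex c (suc k))
    steps k (inj₁ k<m) =
      subst₂ P (sym (cycleVertex-toℕ c (inject₁ i) (trans (toℕ-inject₁ i) (toℕ-fromℕ< k<m))))
               (sym (cycleVertex-toℕ c (fsuc i) (cong suc (toℕ-fromℕ< k<m))))
               (edge i)
      where
      i = fromℕ< k<m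
    steps k (inj₂ refl) =
      subst₂ P (sym (cycleVertex-toℕ c (fromℕ m) (toℕ-fromℕ m))) (sym (cycleVertex-wrap c)) closing

  HasOddCycle⇒oddClosedWalk : HasOddCycle A P → ∃₂ λ x L → Odd L × Walk P x x L
  HasOddCycle⇒oddClosedWalk (m , _ , odd , c , _ , edge , closing) =
    c fzero , suc m , odd , cycle⇒closedWalk c edge closing

  oddClosedWalk-shortcut : ∀ {x L i j} (w : Walk P x x L) → i < j → j < L →
    vertex w i ≡ vertex w j → Odd L → ∃₂ λ y L′ → L′ < L × Odd L′ × Walk P y y L′
  oddClosedWalk-shortcut {x} {i = i} w i<j j<L wi≡wj odd
    with d , refl ← m<n⇒∃[o]m+suc[o]≡n i<j
       | e , refl ← m<n⇒∃[o]m+suc[o]≡n j<L =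
    [ (λ odd-loop  → _ , suc d     , loop<L  , odd-loop  , loop)
    , (λ odd-outer → _ , i + suc e , outer<L , odd-outer , prefix ++ suffix)
    ]′ (odd-+ (suc d) (subst Odd L≡loop+outer odd))
    where
    L≡loop+outer : i + suc d + suc e ≡ suc d + (i + suc e)
    L≡loop+outer = trans (cong (_+ suc e) (+-comm i (suc d))) (+-assoc (suc d) i (suc e))
    loop<L : suc d < i + suc d + suc e
    loop<L = subst (suc d <_) (sym L≡loop+outer)
                   (m<m+n (suc d) (<-≤-trans (z<s {e}) (m≤n+m (suc e) i)))
    outer<L : i + suc e < i + suc d + suc e
    outer<L = subst (i + suc e <_) (sym L≡loop+outer) (m<n+m (i + suc e) (z<s {d}))
    y = vertex w i
    front×suffix : Walk P x y (i + suc d) × Walk P y x (suc e)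
    front×suffix = splitAt (i + suc d) w (sym wi≡wj)
    suffix = proj₂ front×suffix
    prefix×loop : Walk P x y i × Walk P y y (suc d)
    prefix×loop = splitAt i (proj₁ front×suffix) refl
    prefix = proj₁ prefix×loop
    loop   = proj₂ prefix×loop

  HasRepetition : (ℕ → A) → ℕ → Set
  HasRepetition f L = ∃ λ j → j < L × ∃ λ i → i < j × f i ≡ f j

  ¬HasRepetition⇒injective : ∀ {f L} → ¬ HasRepetition f L →
    ∀ (i j : Fin L) → f (toℕ i) ≡ f (toℕ j) → i ≡ j
  ¬HasRepetition⇒injective noRepetition i j fi≡fj with <-cmp (toℕ i) (toℕ j)
  ... | tri< i<j _ _ = contradiction (toℕ j , toℕ<n j , toℕ i , i<j , fi≡fj) noRepetition
  ... | tri≈ _ i≡j _ = toℕ-injective i≡j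
  ... | tri> _ _ j<i = contradiction (toℕ i , toℕ<n i , toℕ j , j<i , sym fi≡fj) noRepetition

  injectiveClosedWalk⇒oddCycle : (∀ {x} → ¬ P x x) → ∀ {x m} (w : Walk P x x (suc m)) → Odd (suc m) →
    (∀ (i j : Fin (suc m)) → vertex w (toℕ i) ≡ vertex w (toℕ j) → i ≡ j) →
    HasOddCycle A P
  injectiveClosedWalk⇒oddCycle P-irrefl {m = zero} w _ _ =
    contradiction (subst (P _) (trans (finish w) (sym (start w))) (step w 0 z<s)) P-irrefl
  injectiveClosedWalk⇒oddCycle _ {m = suc zero} w () _
  injectiveClosedWalk⇒oddCycle _ {m = m@(suc (suc _))} w odd injective =
    m , s≤s (s≤s (s≤s z≤n)) , odd , vertex w ∘ toℕ , injective ,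
    (λ i → subst (λ k → P (vertex w k) (vertex w (suc (toℕ i)))) (sym (toℕ-inject₁ i))
                 (step w (toℕ i) (m<n⇒m<1+n (toℕ<n i)))) ,
    subst₂ P (cong (vertex w) (sym (toℕ-fromℕ m))) (trans (finish w) (sym (start w)))
             (step w m (n<1+n m))

  hasRepetition? : DecidableEquality A → ∀ f L → Dec (HasRepetition f L)
  hasRepetition? _≟_ f = anyUpTo? (λ j → anyUpTo? (λ i → f i ≟ f j) j)

  oddClosedWalk⇒oddCycle : DecidableEquality A → (∀ {x} → ¬ P x x) →
    ∀ {x L} → Walk P x x L → Odd L → HasOddCycle A P
  oddClosedWalk⇒oddCycle _≟_ P-irrefl {L = L} = go (<-wellFounded L)
    where
    go : ∀ {x L} → Acc _<_ L → Walk P x x L → Odd L → HasOddCycle A P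
    go {L = L} (acc shorter) w odd with hasRepetition? _≟_ (vertex w) L
    ... | yes (j , j<L , i , i<j , wi≡wj)
      with _ , _ , L′<L , odd′ , w′ ← oddClosedWalk-shortcut w i<j j<L wi≡wj odd
      = go (shorter L′<L) w′ odd′
    go {L = suc _} _ w odd | no noRepetition =
      injectiveClosedWalk⇒oddCycle P-irrefl w odd (¬HasRepetition⇒injective noRepetition)

HasOddCycle-map : ∀ {A B : Set} {P : A → A → Set} {Q : B → B → Set} →
  DecidableEquality B → (∀ {y} → ¬ Q y y) →
  (φ : A → B) → (∀ {x y} → P x y → Q (φ x) (φ y)) → HasOddCycle A P → HasOddCycle B Q
HasOddCycle-map {P = P} {Q} _≟_ Q-irrefl φ hom cycle
  with _ , _ , odd , w ← HasOddCycle⇒oddClosedWalk {P = P} cycle =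
  oddClosedWalk⇒oddCycle {P = Q} _≟_ Q-irrefl (map φ hom w) odd

lemma8 : (U' : Graph → Set) (R : Graph) →
    (∀ (a b : EVCarrier R) → InEo R a → InEo R b →
      (EVAdj U' R a b → Edge R (proj₁ a) (proj₁ b)) ×
      (EVProperAdj U' R a b →
        ProperEdge R (proj₁ a) (proj₁ b) × proj₁ a ∈ proj₂ b × proj₁ b ∈ proj₂ a) ×
      (EVAdj U' R a b → proj₁ a ≡ proj₁ b → a ≡ b)) ×
    (¬ HasOddCycle (V R) (ProperEdge R) →
      ¬ HasOddCycle (EVCarrier R) (EVProperAdj U' R))
lemma8 U' R =
  (λ _ _ _ _ → EVAdj⇒Edge U' R , EVProperAdj⇒ProperEdge U' R , EVAdj-proj₁-injective U' R) ,
  λ noOddCycle → noOddCycle ∘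
    HasOddCycle-map {P = EVProperAdj U' R} {Q = ProperEdge R} _≟ᶠ_ (λ e → proj₁ e refl) proj₁
      (λ e → proj₁ (EVProperAdj⇒ProperEdge U' R e))
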